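{- For any graphs $G$ and $H$, $\gamma(G\diamond H)=2$ if and only if at least one of the following holds: (i) $\gamma(G)+\gamma(H)=3$; (ii) $G$ or $H$ has an ECD set of size $2$.
   Context: All graphs are finite, simple and undirected. The modular product $G\diamond H$ has vertex set $V(G)\times V(H)$, and two distinct vertices $(g,h)$ and $(g',h')$ are adjacent iff either ($g=g'$ and $hh'\in E(H)$), or ($gg'\in E(G)$ and $h=h'$), or ($gg'\in E(G)$ and $hh'\in E(H)$), or ($g\neq g'$, $h\neq h'$, $gg'\notin E(G)$ and $hh'\notin E(H)$). $\gamma(G)$ denotes the domination number of $G$. $N_G[v]$ is the closed neighborhood of $v$. A set $D\subseteq V(G)$ is an efficiently closed dominating (ECD) set of $G$ if $\{N_G[v]:v\in D\}$ is a partition of $V(G)$. -}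

module Defs where

open import Data.Nat using (ℕ; _≤_; _+_)
open import Data.Bool using (Bool; true; false; _∧_; _∨_; not)
open import Data.Fin using (Fin; remQuot; combine)
open import Data.Fin.Properties using (_≟_)
open import Data.Fin.Subset using (Subset; _∈_; ∣_∣)
open import Data.Product using (Σ; ∃; _×_; _,_; proj₁; proj₂)
open import Data.Sum using (_⊎_)
open import Relation.Nullary using (does)
open import Relation.Binary.PropositionalEquality using (_≡_)

record Graph : Set where
  field
    n      : ℕ
    adj    : Fin n → Fin n → Bool
    sym    : ∀ u v → adj u v ≡ adj v u
    irrefl : ∀ v → adj v v ≡ false
open Graph public

-- Closed neighbourhood membership for an adjacency function: v ∈ N[u].
InN : ∀ {k} → (Fin k → Fin k → Bool) → Fin k → Fin k → Set
InN adj u v = (u ≡ v) ⊎ (adj u v ≡ true)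

IsDominating : ∀ {k} → (Fin k → Fin k → Bool) → Subset k → Set
IsDominating adj D = ∀ v → ∃ λ u → u ∈ D × InN adj u v

DomNumberIs : ∀ {k} → (Fin k → Fin k → Bool) → ℕ → Set
DomNumberIs {k} adj d =
  (∃ λ (D : Subset k) → IsDominating adj D × ∣ D ∣ ≡ d)
  × (∀ (D : Subset k) → IsDominating adj D → d ≤ ∣ D ∣)

-- D is an efficiently closed dominating set: {N[u] : u ∈ D} partitions V,
-- i.e. every vertex lies in N[u] for exactly one u ∈ D.
IsECD : ∀ {k} → (Fin k → Fin k → Bool) → Subset k → Set
IsECD adj D = ∀ v → (∃ λ u → u ∈ D × InN adj u v)
                  × (∀ u u' → u ∈ D → u' ∈ D → InN adj u v → InN adj u' v → u ≡ u')

HasECDOfSize : Graph → ℕ → Set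
HasECDOfSize G s = ∃ λ (D : Subset (n G)) → IsECD (adj G) D × ∣ D ∣ ≡ s

private
  eqb : ∀ {k} → Fin k → Fin k → Bool
  eqb a b = does (a ≟ b)

-- Adjacency of the modular product G ◇ H, vertex (g , h) encoded as combine g h,
-- decoded by remQuot.
modAdj' : (G H : Graph) → Fin (n G) → Fin (n H) → Fin (n G) → Fin (n H) → Bool
modAdj' G H g h g' h' =
     (eqb g g' ∧ adj H h h')
  ∨ (adj G g g' ∧ eqb h h')
  ∨ (adj G g g' ∧ adj H h h')
  ∨ (not (eqb g g') ∧ not (eqb h h') ∧ not (adj G g g') ∧ not (adj H h h'))

modAdj : (G H : Graph) → Fin (n G Data.Nat.* n H) → Fin (n G Data.Nat.* n H) → Bool
modAdj G H x y with remQuot (n H) x | remQuot (n H) y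
... | g , h | g' , h' = modAdj' G H g h g' h'

-- In G ◇ H, (g, h) lies in the closed neighbourhood of (g', h') exactly when g ∈ N[g'] ⇔ h ∈ N[h'].
-- Hence G ◇ H has a universal vertex iff both G and H have one, and {(g₁, h₁), (g₂, h₂)} dominates
-- G ◇ H iff every (g, h) satisfies one of the two agreements g ∈ N[gᵢ] ⇔ h ∈ N[hᵢ].
-- Given such a pair, if some g₀ lies outside N[g₁] ∪ N[g₂], the agreements at (g₀, h), (g₁, h),
-- (g₀, h₂) and (g₁, h₂) force N[h₁] and N[h₂] to partition V(H), so {h₁, h₂} is an ECD set of H;
-- symmetrically with G and H exchanged. Otherwise {g₁, g₂} and {h₁, h₂} both dominate, and if g₂ is not universal
-- then h₁ is: one factor has γ = 1 and, as G ◇ H has no universal vertex, the other has γ = 2.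
-- Conversely, a universal g and a dominating pair {h₁, h₂} give {(g, h₁), (g, h₂)}, and an ECD set
-- {u, v} of G gives {(u, h), (v, h)} for any h.
module Submission where

open import Defs hiding (sym)
open import Data.Bool using (Bool; true; false; _∧_; _∨_; not)
open import Data.Bool.Properties using (∨-zeroʳ; ¬-not; not-¬) renaming (_≟_ to _≟ᵇ_)
open import Data.Fin using (Fin; zero; suc; combine; fromℕ<)
open import Data.Fin.Properties
  using (_≟_; any?; suc-injective; combine-injective; combine-surjective; remQuot-combine)
open import Data.Fin.Subset using (Subset; inside; outside; _∈_; _∪_; ⁅_⁆; ∣_∣; ⊥)
open import Data.Fin.Subset.Properties
  using (x∈⁅x⁆; x∈⁅y⁆⇒x≡y; x∈p∪q⁻; p⊆p∪q; q⊆p∪q; ∣⁅x⁆∣≡1; ∪-identityˡ; ∪-identityʳ; x∈p⇒∣p-x∣<∣p∣)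
open import Data.Nat using (ℕ; zero; suc; _≤_; _+_; _*_; z≤n; s≤s)
import Data.Nat.Properties as ℕ
open import Data.Product using (∃; ∃₂; _×_; _,_; proj₁; proj₂)
open import Data.Sum using (_⊎_; inj₁; inj₂; [_,_]; reduce; fromInj₁; fromInj₂)
import Data.Sum as Sum
open import Data.Sum.Function.Propositional using (_⊎-⇔_)
open import Data.Vec using ([]; _∷_)
open import Function using (_∘_; id)
open import Function.Bundles using (Equivalence; _⇔_; mk⇔)
open import Function.Properties.Equivalence using () renaming (trans to ⇔-trans)
open import Relation.Nullary using (¬_; yes; no; does; contradiction)
open import Relation.Nullary.Decidable using (dec-true; does-⇔; _×-dec_)
open import Relation.Binary.PropositionalEquality using (_≡_; _≢_; refl; sym; trans; cong; cong₂; subst)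

open Equivalence using (to; from)

private
  variable
    k : ℕ

BoolRel : ℕ → Set
BoolRel k = Fin k → Fin k → Bool

≡not⇒≡⊎≡ : ∀ {a b} c → a ≡ not b → a ≡ c ⊎ b ≡ c
≡not⇒≡⊎≡ {b = true}  false refl = inj₁ refl
≡not⇒≡⊎≡ {b = true}  true  refl = inj₂ refl
≡not⇒≡⊎≡ {b = false} false refl = inj₂ refl
≡not⇒≡⊎≡ {b = false} true  refl = inj₁ refl

≡not⇔exactlyOne : ∀ {a b} → a ≡ not b ⇔ ((a ≡ true ⊎ b ≡ true) × ¬ (a ≡ true × b ≡ true))
≡not⇔exactlyOne = mk⇔ (λ a≡¬b → ≡not⇒≡⊎≡ true a≡¬b , notBoth a≡¬b) (λ (one , ¬both) → exactlyOne one ¬both)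
  where
  notBoth : ∀ {a b} → a ≡ not b → ¬ (a ≡ true × b ≡ true)
  notBoth () (refl , refl)
  exactlyOne : ∀ {a b} → a ≡ true ⊎ b ≡ true → ¬ (a ≡ true × b ≡ true) → a ≡ not b
  exactlyOne {true}  {true}  _ ¬both = contradiction (refl , refl) ¬both
  exactlyOne {true}  {false} _ _     = refl
  exactlyOne {false} {true}  _ _     = refl
  exactlyOne {false} {false} (inj₁ ())
  exactlyOne {false} {false} (inj₂ ())

≡∧≡not⇒≢ : ∀ {x y a} → x ≡ a → y ≡ not a → x ≢ y
≡∧≡not⇒≢ refl refl = not-¬ refl

¬both-false : ∀ {a b} → ¬ (a ≡ false × b ≡ false) → a ≡ true ⊎ b ≡ true
¬both-false {true}          _   = inj₁ refl
¬both-false {false} {true}  _   = inj₂ refl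
¬both-false {false} {false} ¬ff = contradiction (refl , refl) ¬ff

-- Subsets with at most two elements

∣p∣≡0⇒p≡⊥ : {p : Subset k} → ∣ p ∣ ≡ 0 → p ≡ ⊥
∣p∣≡0⇒p≡⊥ {p = []}          _ = refl
∣p∣≡0⇒p≡⊥ {p = outside ∷ p} e = cong (outside ∷_) (∣p∣≡0⇒p≡⊥ e)

∣p∣≡1⇒p≡⁅x⁆ : {p : Subset k} → ∣ p ∣ ≡ 1 → ∃ λ x → p ≡ ⁅ x ⁆
∣p∣≡1⇒p≡⁅x⁆ {p = inside ∷ p}  e = zero , cong (inside ∷_) (∣p∣≡0⇒p≡⊥ (ℕ.suc-injective e))
∣p∣≡1⇒p≡⁅x⁆ {p = outside ∷ p} e =
  let x , p≡⁅x⁆ = ∣p∣≡1⇒p≡⁅x⁆ e in suc x , cong (outside ∷_) p≡⁅x⁆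

∣p∣≡2⇒p≡⁅x⁆∪⁅y⁆ : {p : Subset k} → ∣ p ∣ ≡ 2 → ∃₂ λ x y → x ≢ y × p ≡ ⁅ x ⁆ ∪ ⁅ y ⁆
∣p∣≡2⇒p≡⁅x⁆∪⁅y⁆ {p = inside ∷ p} e =
  let y , p≡⁅y⁆ = ∣p∣≡1⇒p≡⁅x⁆ (ℕ.suc-injective e)
  in zero , suc y , (λ ()) , cong (inside ∷_) (trans p≡⁅y⁆ (sym (∪-identityˡ ⁅ y ⁆)))
∣p∣≡2⇒p≡⁅x⁆∪⁅y⁆ {p = outside ∷ p} e =
  let x , y , x≢y , p≡⁅x⁆∪⁅y⁆ = ∣p∣≡2⇒p≡⁅x⁆∪⁅y⁆ e
  in suc x , suc y , x≢y ∘ suc-injective , cong (outside ∷_) p≡⁅x⁆∪⁅y⁆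

∣⁅x⁆∪⁅y⁆∣≡2 : {x y : Fin k} → x ≢ y → ∣ ⁅ x ⁆ ∪ ⁅ y ⁆ ∣ ≡ 2
∣⁅x⁆∪⁅y⁆∣≡2 {x = zero}  {zero}  x≢y = contradiction refl x≢y
∣⁅x⁆∪⁅y⁆∣≡2 {x = zero}  {suc y} _   = cong suc (trans (cong ∣_∣ (∪-identityˡ ⁅ y ⁆)) (∣⁅x⁆∣≡1 y))
∣⁅x⁆∪⁅y⁆∣≡2 {x = suc x} {zero}  _   = cong suc (trans (cong ∣_∣ (∪-identityʳ ⁅ x ⁆)) (∣⁅x⁆∣≡1 x))
∣⁅x⁆∪⁅y⁆∣≡2 {x = suc x} {suc y} x≢y = ∣⁅x⁆∪⁅y⁆∣≡2 (x≢y ∘ cong suc)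

x∈⁅y⁆∪⁅z⁆⇒x≡y⊎x≡z : ∀ {x} (y z : Fin k) → x ∈ ⁅ y ⁆ ∪ ⁅ z ⁆ → x ≡ y ⊎ x ≡ z
x∈⁅y⁆∪⁅z⁆⇒x≡y⊎x≡z y z = Sum.map (x∈⁅y⁆⇒x≡y y) (x∈⁅y⁆⇒x≡y z) ∘ x∈p∪q⁻ ⁅ y ⁆ ⁅ z ⁆

y∈⁅y⁆∪⁅z⁆ : (y z : Fin k) → y ∈ ⁅ y ⁆ ∪ ⁅ z ⁆
y∈⁅y⁆∪⁅z⁆ y z = p⊆p∪q ⁅ z ⁆ (x∈⁅x⁆ y)

z∈⁅y⁆∪⁅z⁆ : (y z : Fin k) → z ∈ ⁅ y ⁆ ∪ ⁅ z ⁆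
z∈⁅y⁆∪⁅z⁆ y z = q⊆p∪q ⁅ y ⁆ ⁅ z ⁆ (x∈⁅x⁆ z)

∃-∈⁅x⁆⇔ : {P : Fin k → Set} {x : Fin k} → (∃ λ y → y ∈ ⁅ x ⁆ × P y) ⇔ P x
∃-∈⁅x⁆⇔ {P = P} {x} = mk⇔
  (λ (y , y∈⁅x⁆ , Py) → subst P (x∈⁅y⁆⇒x≡y x y∈⁅x⁆) Py)
  (λ Px → x , x∈⁅x⁆ x , Px)

∃-∈⁅x⁆∪⁅y⁆⇔ : {P : Fin k → Set} {x y : Fin k} → (∃ λ z → z ∈ ⁅ x ⁆ ∪ ⁅ y ⁆ × P z) ⇔ (P x ⊎ P y)
∃-∈⁅x⁆∪⁅y⁆⇔ {P = P} {x} {y} = mk⇔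
  (λ (z , z∈ , Pz) → Sum.map (λ z≡x → subst P z≡x Pz) (λ z≡y → subst P z≡y Pz) (x∈⁅y⁆∪⁅z⁆⇒x≡y⊎x≡z x y z∈))
  [ (λ Px → x , y∈⁅y⁆∪⁅z⁆ x y , Px) , (λ Py → y , z∈⁅y⁆∪⁅z⁆ x y , Py) ]

-- Domination number one and two

closedAdj : BoolRel k → BoolRel k
closedAdj adj u v = does (u ≟ v) ∨ adj u v

-- For a closed adjacency R, R u v ≡ true reads v ∈ N[u].

Universal : BoolRel k → Fin k → Set
Universal R u = ∀ v → R u v ≡ true

DominatingPair : BoolRel k → Fin k → Fin k → Set
DominatingPair R u v = ∀ w → R u w ≡ true ⊎ R v w ≡ true

Complementary : BoolRel k → Fin k → Fin k → Set
Complementary R u v = ∀ w → R u w ≡ not (R v w)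

universal⊎missed : (R : BoolRel k) (u : Fin k) → Universal R u ⊎ ∃ λ v → R u v ≡ false
universal⊎missed R u with any? (λ v → R u v ≟ᵇ false)
... | yes missed = inj₂ missed
... | no ¬missed = inj₁ (λ v → ¬-not (λ Ruv≡false → ¬missed (v , Ruv≡false)))

dominatingPair⊎missed : (R : BoolRel k) (u v : Fin k) →
  DominatingPair R u v ⊎ ∃ λ w → R u w ≡ false × R v w ≡ false
dominatingPair⊎missed R u v with any? (λ w → (R u w ≟ᵇ false) ×-dec (R v w ≟ᵇ false))
... | yes missed = inj₂ missed
... | no ¬missed = inj₁ (λ w → ¬both-false (λ missed → ¬missed (w , missed)))

complementary⇒¬universal : {R : BoolRel k} → (∀ u v → R u v ≡ R v u) →
  ∀ {u v} → Complementary R u v → ∀ x → ¬ Universal R x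
complementary⇒¬universal R-sym {u} {v} compl x univ =
  ≡not⇔exactlyOne .to (compl x) .proj₂ (trans (R-sym u x) (univ u) , trans (R-sym v x) (univ v))

complementary⇒≢ : {R : BoolRel k} {u v : Fin k} → Complementary R u v → u ≢ v
complementary⇒≢ {u = u} compl refl = not-¬ refl (compl u)

module _ (adj : BoolRel k) where

  InN⇔closedAdj : ∀ {u v} → InN adj u v ⇔ closedAdj adj u v ≡ true
  InN⇔closedAdj {u} {v} = mk⇔ InN⇒closed closed⇒InN
    where
    InN⇒closed : InN adj u v → closedAdj adj u v ≡ true
    InN⇒closed (inj₁ refl) = cong (_∨ adj u u) (dec-true (u ≟ u) refl)
    InN⇒closed (inj₂ uv)   = trans (cong (does (u ≟ v) ∨_) uv) (∨-zeroʳ _)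
    closed⇒InN : closedAdj adj u v ≡ true → InN adj u v
    closed⇒InN uv with u ≟ v
    ... | yes u≡v = inj₁ u≡v
    ... | no _    = inj₂ uv

  closedAdj-refl : ∀ u → closedAdj adj u u ≡ true
  closedAdj-refl u = InN⇔closedAdj .to (inj₁ refl)

  isDominating-⁅x⁆⇔ : ∀ {u} → IsDominating adj ⁅ u ⁆ ⇔ Universal (closedAdj adj) u
  isDominating-⁅x⁆⇔ = mk⇔
    (λ dom v → InN⇔closedAdj .to (∃-∈⁅x⁆⇔ .to (dom v)))
    (λ univ v → ∃-∈⁅x⁆⇔ .from (InN⇔closedAdj .from (univ v)))

  dominatedBy-⁅x⁆∪⁅y⁆⇔ : ∀ {u v w} →
    (∃ λ x → x ∈ ⁅ u ⁆ ∪ ⁅ v ⁆ × InN adj x w) ⇔ (closedAdj adj u w ≡ true ⊎ closedAdj adj v w ≡ true)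
  dominatedBy-⁅x⁆∪⁅y⁆⇔ = ⇔-trans ∃-∈⁅x⁆∪⁅y⁆⇔ (InN⇔closedAdj ⊎-⇔ InN⇔closedAdj)

  isDominating-⁅x⁆∪⁅y⁆⇔ : ∀ {u v} → IsDominating adj (⁅ u ⁆ ∪ ⁅ v ⁆) ⇔ DominatingPair (closedAdj adj) u v
  isDominating-⁅x⁆∪⁅y⁆⇔ = mk⇔
    (λ dom w → dominatedBy-⁅x⁆∪⁅y⁆⇔ .to (dom w))
    (λ pair w → dominatedBy-⁅x⁆∪⁅y⁆⇔ .from (pair w))

  1≤∣dominating∣ : Fin k → ∀ {D} → IsDominating adj D → 1 ≤ ∣ D ∣
  1≤∣dominating∣ v dom = let _ , u∈D , _ = dom v in ℕ.≤-trans (s≤s z≤n) (x∈p⇒∣p-x∣<∣p∣ u∈D)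

  2≤∣dominating∣ : Fin k → (∀ u → ¬ Universal (closedAdj adj) u) → ∀ {D} → IsDominating adj D → 2 ≤ ∣ D ∣
  2≤∣dominating∣ v ¬univ {D} dom with ∣ D ∣ in ∣D∣≡ | 1≤∣dominating∣ v dom
  ... | suc (suc _) | _ = s≤s (s≤s z≤n)
  ... | suc zero    | _ =
    let u , D≡⁅u⁆ = ∣p∣≡1⇒p≡⁅x⁆ ∣D∣≡
    in contradiction (isDominating-⁅x⁆⇔ .to (subst (IsDominating adj) D≡⁅u⁆ dom)) (¬univ u)

  domNumber-positive : Fin k → ∀ {d} → DomNumberIs adj d → 1 ≤ d
  domNumber-positive v ((_ , dom , refl) , _) = 1≤∣dominating∣ v dom

  domNumber≡1⇔ : Fin k → DomNumberIs adj 1 ⇔ ∃ (Universal (closedAdj adj))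
  domNumber≡1⇔ v = mk⇔
    (λ ((D , dom , ∣D∣≡1) , _) →
      let u , D≡⁅u⁆ = ∣p∣≡1⇒p≡⁅x⁆ ∣D∣≡1
      in u , isDominating-⁅x⁆⇔ .to (subst (IsDominating adj) D≡⁅u⁆ dom))
    (λ (u , univ) → (⁅ u ⁆ , isDominating-⁅x⁆⇔ .from univ , ∣⁅x⁆∣≡1 u) , λ _ → 1≤∣dominating∣ v)

  domNumber≡2⇔ : Fin k →
    DomNumberIs adj 2 ⇔ ((∀ u → ¬ Universal (closedAdj adj) u) × ∃₂ (DominatingPair (closedAdj adj)))
  domNumber≡2⇔ w = mk⇔
    (λ ((D , dom , ∣D∣≡2) , minimal) →
      let u , v , _ , D≡⁅u⁆∪⁅v⁆ = ∣p∣≡2⇒p≡⁅x⁆∪⁅y⁆ ∣D∣≡2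
      in ¬universal minimal , u , v , isDominating-⁅x⁆∪⁅y⁆⇔ .to (subst (IsDominating adj) D≡⁅u⁆∪⁅v⁆ dom))
    (λ (¬univ , u , v , pair) →
      let u≢v = λ u≡v → ¬univ u (reduce ∘ subst (DominatingPair (closedAdj adj) u) (sym u≡v) pair)
      in (⁅ u ⁆ ∪ ⁅ v ⁆ , isDominating-⁅x⁆∪⁅y⁆⇔ .from pair , ∣⁅x⁆∪⁅y⁆∣≡2 u≢v) , λ _ → 2≤∣dominating∣ w ¬univ)
    where
    ¬universal : (∀ D → IsDominating adj D → 2 ≤ ∣ D ∣) → ∀ u → ¬ Universal (closedAdj adj) u
    ¬universal minimal u univ
      with s≤s () ← subst (2 ≤_) (∣⁅x⁆∣≡1 u) (minimal ⁅ u ⁆ (isDominating-⁅x⁆⇔ .from univ))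

  isECD-⁅x⁆∪⁅y⁆⇔ : ∀ {u v} → u ≢ v → IsECD adj (⁅ u ⁆ ∪ ⁅ v ⁆) ⇔ Complementary (closedAdj adj) u v
  isECD-⁅x⁆∪⁅y⁆⇔ {u} {v} u≢v = mk⇔
    (λ ecd w → ≡not⇔exactlyOne .from (dominatedBy-⁅x⁆∪⁅y⁆⇔ .to (ecd w .proj₁) , ¬both⇐unique (ecd w .proj₂)))
    (λ compl w → let one , ¬both = ≡not⇔exactlyOne .to (compl w)
                 in dominatedBy-⁅x⁆∪⁅y⁆⇔ .from one , unique⇐¬both ¬both)
    where
    D : Subset k
    D = ⁅ u ⁆ ∪ ⁅ v ⁆
    UniquelyDominated : Fin k → Set
    UniquelyDominated w = ∀ x y → x ∈ D → y ∈ D → InN adj x w → InN adj y w → x ≡ y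
    ¬both⇐unique : ∀ {w} → UniquelyDominated w → ¬ (closedAdj adj u w ≡ true × closedAdj adj v w ≡ true)
    ¬both⇐unique unique (uw , vw) =
      u≢v (unique u v (y∈⁅y⁆∪⁅z⁆ u v) (z∈⁅y⁆∪⁅z⁆ u v) (InN⇔closedAdj .from uw) (InN⇔closedAdj .from vw))
    unique⇐¬both : ∀ {w} → ¬ (closedAdj adj u w ≡ true × closedAdj adj v w ≡ true) → UniquelyDominated w
    unique⇐¬both ¬both x y x∈D y∈D xw yw with x∈⁅y⁆∪⁅z⁆⇒x≡y⊎x≡z u v x∈D | x∈⁅y⁆∪⁅z⁆⇒x≡y⊎x≡z u v y∈D
    ... | inj₁ refl | inj₁ refl = refl
    ... | inj₂ refl | inj₂ refl = refl
    ... | inj₁ refl | inj₂ refl = contradiction (InN⇔closedAdj .to xw , InN⇔closedAdj .to yw) ¬both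
    ... | inj₂ refl | inj₁ refl = contradiction (InN⇔closedAdj .to yw , InN⇔closedAdj .to xw) ¬both

N[_] : (G : Graph) → BoolRel (n G)
N[ G ] = closedAdj (adj G)

closedAdj-sym : (G : Graph) → ∀ u v → N[ G ] u v ≡ N[ G ] v u
closedAdj-sym G u v = cong₂ _∨_ (does-⇔ (mk⇔ sym sym) (u ≟ v) (v ≟ u)) (Graph.sym G u v)

hasECDOfSize2⇔ : (G : Graph) → HasECDOfSize G 2 ⇔ ∃₂ (Complementary N[ G ])
hasECDOfSize2⇔ G = mk⇔
  (λ (D , ecd , ∣D∣≡2) →
    let u , v , u≢v , D≡⁅u⁆∪⁅v⁆ = ∣p∣≡2⇒p≡⁅x⁆∪⁅y⁆ ∣D∣≡2
    in u , v , isECD-⁅x⁆∪⁅y⁆⇔ (adj G) u≢v .to (subst (IsECD (adj G)) D≡⁅u⁆∪⁅v⁆ ecd))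
  (λ (u , v , compl) →
    let u≢v = complementary⇒≢ {R = N[ G ]} compl
    in ⁅ u ⁆ ∪ ⁅ v ⁆ , isECD-⁅x⁆∪⁅y⁆⇔ (adj G) u≢v .from compl , ∣⁅x⁆∪⁅y⁆∣≡2 u≢v)

-- Dominating pairs of a modular product

ModularDominatingPair : ∀ {p q} → BoolRel p → BoolRel q → Fin p → Fin q → Fin p → Fin q → Set
ModularDominatingPair A B g₁ h₁ g₂ h₂ = ∀ g h → A g₁ g ≡ B h₁ h ⊎ A g₂ g ≡ B h₂ h

ModularDomNumber≡2 : ∀ {p q} → BoolRel p → BoolRel q → Set
ModularDomNumber≡2 A B =
  (∀ g h → ¬ (Universal A g × Universal B h))
  × ∃₂ λ g₁ g₂ → ∃₂ λ h₁ h₂ → ModularDominatingPair A B g₁ h₁ g₂ h₂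

module _ {p q} (A : BoolRel p) (B : BoolRel q) where

  modularDominatingPair-swap : ∀ {g₁ h₁ g₂ h₂} →
    ModularDominatingPair A B g₁ h₁ g₂ h₂ → ModularDominatingPair B A h₁ g₁ h₂ g₂
  modularDominatingPair-swap pair h g = Sum.map sym sym (pair g h)

  modularDomNumber≡2-swap : ModularDomNumber≡2 A B → ModularDomNumber≡2 B A
  modularDomNumber≡2-swap (¬univ , g₁ , g₂ , h₁ , h₂ , pair) =
    (λ h g (univB , univA) → ¬univ g h (univA , univB)) , h₁ , h₂ , g₁ , g₂ , modularDominatingPair-swap pair

  modularDomNumber≡2-of-universal : ∀ {g h₁ h₂} →
    Universal A g → (∀ h → ¬ Universal B h) → DominatingPair B h₁ h₂ → ModularDomNumber≡2 A B
  modularDomNumber≡2-of-universal {g} {h₁} {h₂} univ ¬univB pair =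
    (λ _ h (_ , univH) → ¬univB h univH) , g , g , h₁ , h₂ ,
    λ g' h → Sum.map (trans (univ g') ∘ sym) (trans (univ g') ∘ sym) (pair h)

  modularDomNumber≡2-of-complementary : ∀ {g₁ g₂} →
    (∀ g → ¬ Universal A g) → Complementary A g₁ g₂ → Fin q → ModularDomNumber≡2 A B
  modularDomNumber≡2-of-complementary {g₁} {g₂} ¬univA compl h =
    (λ g _ (univG , _) → ¬univA g univG) , g₁ , g₂ , h , h , λ g h' → ≡not⇒≡⊎≡ (B h h') (compl g)

  module _ {g₁ h₁ g₂ h₂} (pair : ModularDominatingPair A B g₁ h₁ g₂ h₂) where

    agrees₁ : ∀ {g h a} → A g₂ g ≡ a → B h₂ h ≡ not a → A g₁ g ≡ B h₁ h
    agrees₁ A₂g B₂h = fromInj₁ (λ A₂g≡B₂h → contradiction A₂g≡B₂h (≡∧≡not⇒≢ A₂g B₂h)) (pair _ _)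

    agrees₂ : ∀ {g h a} → A g₁ g ≡ a → B h₁ h ≡ not a → A g₂ g ≡ B h₂ h
    agrees₂ A₁g B₁h = fromInj₂ (λ A₁g≡B₁h → contradiction A₁g≡B₁h (≡∧≡not⇒≢ A₁g B₁h)) (pair _ _)

    missed⇒complementary : (∀ g → A g g ≡ true) → (∀ h → B h h ≡ true) →
      ∀ {g₀} → A g₁ g₀ ≡ false → A g₂ g₀ ≡ false → Complementary B h₁ h₂
    missed⇒complementary A-refl B-refl {g₀} A₁g₀ A₂g₀ h with B h₁ h in B₁h | B h₂ h in B₂h
    ... | true  | false = refl
    ... | false | true  = refl
    ... | true  | true  = contradiction (trans (sym A₂g₀) (trans (agrees₂ A₁g₀ B₁h) B₂h)) λ ()
    -- h ∉ N[h₁] ∪ N[h₂]: the agreements at (g₁, h) and (g₀, h₂) leave none at (g₁, h₂).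
    ... | false | false =
      contradiction (trans (sym A₂g₁) (trans (agrees₂ (A-refl g₁) B₁h₂) (B-refl h₂))) λ ()
      where
      A₂g₁ : A g₂ g₁ ≡ false
      A₂g₁ = trans (agrees₂ (A-refl g₁) B₁h) B₂h
      B₁h₂ : B h₁ h₂ ≡ false
      B₁h₂ = trans (sym (agrees₁ A₂g₀ (B-refl h₂))) A₁g₀

    missed⇒universal : DominatingPair A g₁ g₂ → DominatingPair B h₁ h₂ →
      ∀ {g} → A g₂ g ≡ false → Universal B h₁
    missed⇒universal pairA pairB {g} A₂g h = [ id , (λ B₂h → trans (sym (agrees₁ A₂g B₂h)) A₁g) ] (pairB h)
      where
      A₁g : A g₁ g ≡ true
      A₁g = fromInj₁ (λ A₂g≡true → contradiction (trans (sym A₂g) A₂g≡true) λ ()) (pairA g)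

modularDominatingPair-cases : ∀ {p q} {A : BoolRel p} {B : BoolRel q} →
  (∀ g → A g g ≡ true) → (∀ h → B h h ≡ true) →
  ∀ {g₁ h₁ g₂ h₂} → ModularDominatingPair A B g₁ h₁ g₂ h₂ →
  ((∃ (Universal A) × DominatingPair B h₁ h₂) ⊎ (DominatingPair A g₁ g₂ × ∃ (Universal B)))
  ⊎ (Complementary A g₁ g₂ ⊎ Complementary B h₁ h₂)
modularDominatingPair-cases {A = A} {B} A-refl B-refl {g₁} {h₁} {g₂} {h₂} pair
  with dominatingPair⊎missed A g₁ g₂ | dominatingPair⊎missed B h₁ h₂
... | inj₂ (_ , A₁g₀ , A₂g₀) | _ =
  inj₂ (inj₂ (missed⇒complementary A B pair A-refl B-refl A₁g₀ A₂g₀))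
... | inj₁ _ | inj₂ (_ , B₁h₀ , B₂h₀) =
  inj₂ (inj₁ (missed⇒complementary B A (modularDominatingPair-swap A B pair) B-refl A-refl B₁h₀ B₂h₀))
... | inj₁ pairA | inj₁ pairB with universal⊎missed A g₂
...   | inj₁ univ      = inj₁ (inj₁ ((g₂ , univ) , pairB))
...   | inj₂ (_ , A₂g) = inj₁ (inj₂ (pairA , h₁ , missed⇒universal A B pair pairA pairB A₂g))

-- The modular product of graphs

-- modAdj' G H g h g' h' unfolds to modularEdge (does (g ≟ g')) (does (h ≟ h')) (adj G g g') (adj H h h').
modularEdge : Bool → Bool → Bool → Bool → Bool
modularEdge eg eh ag ah = (eg ∧ ah) ∨ (ag ∧ eh) ∨ (ag ∧ ah) ∨ (not eg ∧ not eh ∧ not ag ∧ not ah)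

closed-modularEdge⇔ : ∀ eg eh ag ah →
  ((eg ∧ eh) ∨ modularEdge eg eh ag ah) ≡ true ⇔ ((eg ∨ ag) ≡ (eh ∨ ah))
closed-modularEdge⇔ true  true  _     _     = mk⇔ (λ _ → refl) (λ _ → refl)
closed-modularEdge⇔ true  false false false = mk⇔ (λ ()) (λ ())
closed-modularEdge⇔ true  false false true  = mk⇔ (λ _ → refl) (λ _ → refl)
closed-modularEdge⇔ true  false true  false = mk⇔ (λ ()) (λ ())
closed-modularEdge⇔ true  false true  true  = mk⇔ (λ _ → refl) (λ _ → refl)
closed-modularEdge⇔ false true  false false = mk⇔ (λ ()) (λ ())
closed-modularEdge⇔ false true  false true  = mk⇔ (λ ()) (λ ())
closed-modularEdge⇔ false true  true  false = mk⇔ (λ _ → refl) (λ _ → refl)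
closed-modularEdge⇔ false true  true  true  = mk⇔ (λ _ → refl) (λ _ → refl)
closed-modularEdge⇔ false false false false = mk⇔ (λ _ → refl) (λ _ → refl)
closed-modularEdge⇔ false false false true  = mk⇔ (λ ()) (λ ())
closed-modularEdge⇔ false false true  false = mk⇔ (λ ()) (λ ())
closed-modularEdge⇔ false false true  true  = mk⇔ (λ _ → refl) (λ _ → refl)

combine≡combine⇔ : ∀ {m n} {g g' : Fin m} {h h' : Fin n} →
  combine g h ≡ combine g' h' ⇔ (g ≡ g' × h ≡ h')
combine≡combine⇔ = mk⇔ (combine-injective _ _ _ _) (λ { (refl , refl) → refl })

∀-combine : ∀ {m n} {P : Fin (m * n) → Set} → (∀ g h → P (combine g h)) → ∀ x → P x
∀-combine {m} {n} {P} f x = let g , h , gh≡x = combine-surjective {m} {n} x in subst P gh≡x (f g h)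

module _ (G H : Graph) where

  modAdj-combine : ∀ g h g' h' → modAdj G H (combine g h) (combine g' h') ≡ modAdj' G H g h g' h'
  modAdj-combine g h g' h' =
    cong₂ (λ (g , h) (g' , h') → modAdj' G H g h g' h')
          (remQuot-combine {n G} {n H} g h) (remQuot-combine g' h')

  closedAdj-modular⇔ : ∀ g h g' h' →
    closedAdj (modAdj G H) (combine g h) (combine g' h') ≡ true ⇔ (N[ G ] g g' ≡ N[ H ] h h')
  closedAdj-modular⇔ g h g' h' =
    subst (λ b → b ≡ true ⇔ (N[ G ] g g' ≡ N[ H ] h h')) (sym unfold)
      (closed-modularEdge⇔ (does (g ≟ g')) (does (h ≟ h')) (adj G g g') (adj H h h'))
    where
    unfold : closedAdj (modAdj G H) (combine g h) (combine g' h')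
             ≡ (does (g ≟ g') ∧ does (h ≟ h')) ∨ modAdj' G H g h g' h'
    unfold = cong₂ _∨_
      (does-⇔ (combine≡combine⇔ {n G} {n H}) (combine g h ≟ combine g' h') ((g ≟ g') ×-dec (h ≟ h')))
      (modAdj-combine g h g' h')

  universal-modular⇔ : ∀ {g h} →
    Universal (closedAdj (modAdj G H)) (combine g h) ⇔ (Universal N[ G ] g × Universal N[ H ] h)
  universal-modular⇔ {g} {h} = mk⇔
    (λ univ →
        (λ g' → trans (closedAdj-modular⇔ g h g' h .to (univ (combine g' h))) (closedAdj-refl (adj H) h))
      , (λ h' → trans (sym (closedAdj-modular⇔ g h g h' .to (univ (combine g h')))) (closedAdj-refl (adj G) g)))
    (λ (univG , univH) →
      ∀-combine λ g' h' → closedAdj-modular⇔ g h g' h' .from (trans (univG g') (sym (univH h'))))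

  dominatingPair-modular⇔ : ∀ {g₁ h₁ g₂ h₂} →
    DominatingPair (closedAdj (modAdj G H)) (combine g₁ h₁) (combine g₂ h₂)
    ⇔ ModularDominatingPair N[ G ] N[ H ] g₁ h₁ g₂ h₂
  dominatingPair-modular⇔ = mk⇔
    (λ pair g h → (closedAdj-modular⇔ _ _ g h ⊎-⇔ closedAdj-modular⇔ _ _ g h) .to (pair (combine g h)))
    (λ pair → ∀-combine λ g h → (closedAdj-modular⇔ _ _ g h ⊎-⇔ closedAdj-modular⇔ _ _ g h) .from (pair g h))

  domNumber-modular≡2⇔ : Fin (n G) → Fin (n H) →
    DomNumberIs (modAdj G H) 2 ⇔ ModularDomNumber≡2 N[ G ] N[ H ]
  domNumber-modular≡2⇔ g₀ h₀ = ⇔-trans (domNumber≡2⇔ (modAdj G H) (combine g₀ h₀)) (mk⇔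
    (λ (¬univ , pair) → (λ g h → ¬univ (combine g h) ∘ universal-modular⇔ .from) , coordinates pair)
    (λ (¬univ , g₁ , g₂ , h₁ , h₂ , pair) →
      ∀-combine (λ g h → ¬univ g h ∘ universal-modular⇔ .to)
      , combine g₁ h₁ , combine g₂ h₂ , dominatingPair-modular⇔ .from pair))
    where
    coordinates : ∃₂ (DominatingPair (closedAdj (modAdj G H))) →
      ∃₂ λ g₁ g₂ → ∃₂ λ h₁ h₂ → ModularDominatingPair N[ G ] N[ H ] g₁ h₁ g₂ h₂
    coordinates (x₁ , x₂ , pair) with combine-surjective {n G} {n H} x₁ | combine-surjective {n G} {n H} x₂
    ... | g₁ , h₁ , refl | g₂ , h₂ , refl = g₁ , g₂ , h₁ , h₂ , dominatingPair-modular⇔ .to pair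

+≡3⇒1+2⊎2+1 : ∀ {a b} → a + b ≡ 3 → 1 ≤ a → 1 ≤ b → (a ≡ 1 × b ≡ 2) ⊎ (a ≡ 2 × b ≡ 1)
+≡3⇒1+2⊎2+1 {0}                       refl ()  _
+≡3⇒1+2⊎2+1 {1}                       refl _   _  = inj₁ (refl , refl)
+≡3⇒1+2⊎2+1 {2}                       refl _   _  = inj₂ (refl , refl)
+≡3⇒1+2⊎2+1 {3}                       refl _   ()
+≡3⇒1+2⊎2+1 {suc (suc (suc (suc _)))} ()

DomNumbersSumTo3 : Graph → Graph → Set
DomNumbersSumTo3 G H = ∃₂ λ a b → DomNumberIs (adj G) a × DomNumberIs (adj H) b × a + b ≡ 3

module _ (G H : Graph) (g₀ : Fin (n G)) (h₀ : Fin (n H)) where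

  domNumber-modular≡2⇒ :
    DomNumberIs (modAdj G H) 2 → DomNumbersSumTo3 G H ⊎ (HasECDOfSize G 2 ⊎ HasECDOfSize H 2)
  domNumber-modular≡2⇒ γ≡2 with domNumber-modular≡2⇔ G H g₀ h₀ .to γ≡2
  ... | ¬univ , g₁ , g₂ , h₁ , h₂ , pair =
    Sum.map [ 1+2 , 2+1 ]
            (Sum.map (λ compl → hasECDOfSize2⇔ G .from (g₁ , g₂ , compl))
                     (λ compl → hasECDOfSize2⇔ H .from (h₁ , h₂ , compl)))
      (modularDominatingPair-cases (closedAdj-refl (adj G)) (closedAdj-refl (adj H)) pair)
    where
    1+2 : ∃ (Universal N[ G ]) × DominatingPair N[ H ] h₁ h₂ → DomNumbersSumTo3 G H
    1+2 ((g , univG) , pairH) =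
      1 , 2 , domNumber≡1⇔ (adj G) g₀ .from (g , univG)
            , domNumber≡2⇔ (adj H) h₀ .from ((λ h univH → ¬univ g h (univG , univH)) , h₁ , h₂ , pairH)
            , refl
    2+1 : DominatingPair N[ G ] g₁ g₂ × ∃ (Universal N[ H ]) → DomNumbersSumTo3 G H
    2+1 (pairG , (h , univH)) =
      2 , 1 , domNumber≡2⇔ (adj G) g₀ .from ((λ g univG → ¬univ g h (univG , univH)) , g₁ , g₂ , pairG)
            , domNumber≡1⇔ (adj H) h₀ .from (h , univH)
            , refl

  domNumber-modular≡2⇐ :
    DomNumbersSumTo3 G H ⊎ (HasECDOfSize G 2 ⊎ HasECDOfSize H 2) → DomNumberIs (modAdj G H) 2
  domNumber-modular≡2⇐ = domNumber-modular≡2⇔ G H g₀ h₀ .from ∘ [ fromDomNumbers , [ fromECDᴳ , fromECDᴴ ] ]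
    where
    fromDomNumbers : DomNumbersSumTo3 G H → ModularDomNumber≡2 N[ G ] N[ H ]
    fromDomNumbers (_ , _ , γG , γH , a+b≡3)
      with +≡3⇒1+2⊎2+1 a+b≡3 (domNumber-positive (adj G) g₀ γG) (domNumber-positive (adj H) h₀ γH)
    ... | inj₁ (refl , refl) =
      let _ , univG = domNumber≡1⇔ (adj G) g₀ .to γG
          ¬univH , _ , _ , pairH = domNumber≡2⇔ (adj H) h₀ .to γH
      in modularDomNumber≡2-of-universal N[ G ] N[ H ] univG ¬univH pairH
    ... | inj₂ (refl , refl) =
      let ¬univG , _ , _ , pairG = domNumber≡2⇔ (adj G) g₀ .to γG
          _ , univH = domNumber≡1⇔ (adj H) h₀ .to γH
      in modularDomNumber≡2-swap N[ H ] N[ G ]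
           (modularDomNumber≡2-of-universal N[ H ] N[ G ] univH ¬univG pairG)
    fromECDᴳ : HasECDOfSize G 2 → ModularDomNumber≡2 N[ G ] N[ H ]
    fromECDᴳ ecd =
      let _ , _ , compl = hasECDOfSize2⇔ G .to ecd
          ¬univG = complementary⇒¬universal (closedAdj-sym G) compl
      in modularDomNumber≡2-of-complementary N[ G ] N[ H ] ¬univG compl h₀
    fromECDᴴ : HasECDOfSize H 2 → ModularDomNumber≡2 N[ G ] N[ H ]
    fromECDᴴ ecd =
      let _ , _ , compl = hasECDOfSize2⇔ H .to ecd
          ¬univH = complementary⇒¬universal (closedAdj-sym H) compl
      in modularDomNumber≡2-swap N[ H ] N[ G ]
           (modularDomNumber≡2-of-complementary N[ H ] N[ G ] ¬univH compl g₀)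

theorem23 : (G H : Graph) → 1 ≤ n G → 1 ≤ n H →
    DomNumberIs (modAdj G H) 2
      ⇔ ((∃₂ λ a b → DomNumberIs (adj G) a × DomNumberIs (adj H) b × a + b ≡ 3)
         ⊎ (HasECDOfSize G 2 ⊎ HasECDOfSize H 2))
theorem23 G H 1≤nG 1≤nH = mk⇔ (domNumber-modular≡2⇒ G H g₀ h₀) (domNumber-modular≡2⇐ G H g₀ h₀)
  where
  g₀ : Fin (n G)
  g₀ = fromℕ< 1≤nG
  h₀ : Fin (n H)
  h₀ = fromℕ< 1≤nH
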